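{- For every $k\in\mathbb{N}$, with \[ F_{k,1}(q)=\sum_{n\ge 0}\frac{\left(q^{2n+2};q^2\right)_\infty\left(q^{2n+2k};q^2\right)_\infty}{\left(q^{2n+1};q^2\right)_\infty^2}\,q^{2n+1} \quad\text{and}\quad \omega(q)=\sum_{n\ge0}\frac{q^{2n(n+1)}}{\left(q;q^2\right)_{n+1}^2}, \] we have \[ q\,\omega(q)-F_{k,1}(q)=q^{2k+1}E_k(q) \] for some formal power series $E_k(q)\in\mathbb{Z}[[q]]$ whose constant coefficient equals $1$.
   Context: For $n\in\mathbb{N}_0\cup\{\infty\}$, $(a;q)_n:=\prod_{j=0}^{n-1}(1-aq^j)$. All series are formal power series in $q$. -}

module Defs where

open import Data.Nat as ℕ using (ℕ; zero; suc; _∸_)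
open import Data.Nat.Divisibility using (_∣?_)
open import Data.Integer using (ℤ; 0ℤ; 1ℤ; _+_; _*_; _-_)
open import Relation.Nullary using (yes; no)

-- Formal power series in q over ℤ, represented by coefficient sequences:
-- f n is the coefficient of q^n.
PS : Set
PS = ℕ → ℤ

Σ< : ℕ → (ℕ → ℤ) → ℤ
Σ< zero    f = 0ℤ
Σ< (suc n) f = Σ< n f + f n

_⊕_ : PS → PS → PS
(f ⊕ g) n = f n + g n

_⊖_ : PS → PS → PS
(f ⊖ g) n = f n - g n

_⊛_ : PS → PS → PS
(f ⊛ g) n = Σ< (suc n) (λ i → f i * g (n ∸ i))

infixl 6 _⊕_ _⊖_
infixl 7 _⊛_

qpow : ℕ → PS
qpow a n with a ℕ.≟ n
... | yes _ = 1ℤ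
... | no  _ = 0ℤ

one : PS
one = qpow 0

oneMinusQ : ℕ → PS
oneMinusQ a = one ⊖ qpow a

-- 1/(1 - q^a) = Σ_{j≥0} q^{a j}, for a ≥ 1
geom : ℕ → PS
geom a n with a ∣? n
... | yes _ = 1ℤ
... | no  _ = 0ℤ

prodTo : ℕ → (ℕ → PS) → PS
prodTo zero    f = one
prodTo (suc n) f = prodTo n f ⊛ f n

poch : ℕ → ℕ → ℕ → PS
poch b d n = prodTo n (λ j → oneMinusQ (b ℕ.+ j ℕ.* d))

-- (q^b ; q^d)_∞ for d ≥ 1: coefficient m only depends on factors j ≤ m
pochInf : ℕ → ℕ → PS
pochInf b d m = poch b d (suc m) m

-- 1/(q^b ; q^d)_n = ∏_{j<n} 1/(1 - q^{b + j d})   (b ≥ 1)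
invPoch : ℕ → ℕ → ℕ → PS
invPoch b d n = prodTo n (λ j → geom (b ℕ.+ j ℕ.* d))

-- 1/(q^b ; q^d)_∞ for b, d ≥ 1
invPochInf : ℕ → ℕ → PS
invPochInf b d m = invPoch b d (suc m) m

-- Σ_{n≥0} T n, valid when T n has q-order ≥ n (true for both uses below)
sumInf : (ℕ → PS) → PS
sumInf T m = Σ< (suc m) (λ n → T n m)

F : ℕ → PS
F k = sumInf (λ n →
        pochInf (2 ℕ.* n ℕ.+ 2) 2 ⊛ pochInf (2 ℕ.* n ℕ.+ 2 ℕ.* k) 2
        ⊛ invPochInf (2 ℕ.* n ℕ.+ 1) 2 ⊛ invPochInf (2 ℕ.* n ℕ.+ 1) 2
        ⊛ qpow (2 ℕ.* n ℕ.+ 1))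

ω : PS
ω = sumInf (λ n →
      qpow (2 ℕ.* n ℕ.* (n ℕ.+ 1)) ⊛ invPoch 1 2 (suc n) ⊛ invPoch 1 2 (suc n))

{-# OPTIONS --safe #-}
-- Write [a] for (q^a;q^2)_∞ and Φ(α,β) = Σ_n q^{2n} [2n+2] / ([2n+α] [2n+β]). The n-th term of
-- (1 - q^α) Φ(α,β) - q^β Φ(α+2,β) is V(n+1) - V(n) with V(n) = [2n] / ([2n+α] [2n+β]); as V(0) = 0
-- and V(n) → 1, this difference is 1. Using it at (α,β) and, by the symmetry of Φ, at (β,α+2) gives
-- (1 - q^α)^2 Φ(α,α) = 1 + q^{2α+2} Φ(α+2,α+2). Shifting n shows that
-- R(α) = Σ_n q^{2n(n+α)} / (q^α;q^2)_{n+1}^2, with R(1) = ω, satisfies the same recurrence. So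
-- D(α) = Φ(α,α) - R(α) satisfies (1 - q^α)^2 D(α) = q^{2α+2} D(α+2); since 1 - q^α is invertible, the
-- q-adic order of D(α) exceeds that of D(α+2), and by descent D = 0, i.e. q ω = q Φ(1,1). Finally
-- q Φ(1,1) - F_{k,1} = Σ_n q^{2n+1} [2n+2] / [2n+1]^2 · (1 - [2n+2k]), whose terms with n ≥ 1 are
-- O(q^{2k+2}), while 1 - [2k] ≡ q^{2k} mod q^{2k+2}; so the difference is q^{2k+1} [2] / [1]^2 + O(q^{2k+2}).

module Submission where

open import Defs
open import Data.Nat using (ℕ; _≤_; _+_; _*_)
open import Data.Integer using (ℤ; 1ℤ)
open import Data.Product using (Σ; _×_)
open import Relation.Binary.PropositionalEquality using (_≡_)

open import Data.Nat using (zero; suc; _∸_; _<_; _≤?_; _<?_; z≤n; s≤s)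
import Data.Nat as ℕ
import Data.Nat.Properties as ℕ
open import Data.Nat.Tactic.RingSolver using (solve-∀)
open import Data.Nat.Divisibility using (_∣_; _∣?_; _∣0; ∣⇒≤; ∣m+n∣m⇒∣n; ∣m∸n∣n⇒∣m; ∣-refl)
open import Data.Integer using (0ℤ; -_) renaming (_+_ to _+ℤ_; _*_ to _*ℤ_; _-_ to _-ℤ_)
import Data.Integer as ℤ
import Data.Integer.Properties as ℤ
open import Algebra.Properties.CommutativeSemigroup ℤ.+-commutativeSemigroup using (interchange)
open import Data.Product using (_,_)
open import Data.Sum using (inj₁; inj₂)
open import Data.Empty using (⊥-elim)
open import Relation.Nullary using (¬_; Dec; yes; no)
open import Relation.Binary.PropositionalEquality using (refl; sym; trans; cong; cong₂; subst; module ≡-Reasoning)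
open import Data.Maybe using (Maybe; just; nothing)
open import Algebra.Bundles using (CommutativeRing)
open import Relation.Binary.Bundles using (Setoid)
open import Algebra.Structures using (IsCommutativeRing)
open import Algebra.Solver.Ring.AlmostCommutativeRing using (fromCommutativeRing; _-Raw-AlmostCommutative⟶_)
import Algebra.Solver.Ring
import Algebra.Solver.CommutativeMonoid
import Relation.Binary.Reasoning.Setoid

-- Finite sums

Σ<-cong : ∀ n {f g : ℕ → ℤ} → (∀ i → i < n → f i ≡ g i) → Σ< n f ≡ Σ< n g
Σ<-cong zero    f≡g = refl
Σ<-cong (suc n) f≡g = cong₂ _+ℤ_ (Σ<-cong n (λ i i<n → f≡g i (ℕ.m<n⇒m<1+n i<n))) (f≡g n ℕ.≤-refl)

Σ<-zero : ∀ n {f : ℕ → ℤ} → (∀ i → i < n → f i ≡ 0ℤ) → Σ< n f ≡ 0ℤ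
Σ<-zero zero    f≡0 = refl
Σ<-zero (suc n) f≡0 = cong₂ _+ℤ_ (Σ<-zero n (λ i i<n → f≡0 i (ℕ.m<n⇒m<1+n i<n))) (f≡0 n ℕ.≤-refl)

Σ<-distrib-+ : ∀ n (f g : ℕ → ℤ) → Σ< n (λ i → f i +ℤ g i) ≡ Σ< n f +ℤ Σ< n g
Σ<-distrib-+ zero    f g = refl
Σ<-distrib-+ (suc n) f g =
  trans (cong (_+ℤ (f n +ℤ g n)) (Σ<-distrib-+ n f g)) (interchange (Σ< n f) (Σ< n g) (f n) (g n))

Σ<-distrib-minus : ∀ n (f g : ℕ → ℤ) → Σ< n (λ i → f i -ℤ g i) ≡ Σ< n f -ℤ Σ< n g
Σ<-distrib-minus n f g = trans (Σ<-distrib-+ n f (λ i → - g i)) (cong (Σ< n f +ℤ_) (Σ<-neg n))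
  where
  Σ<-neg : ∀ n → Σ< n (λ i → - g i) ≡ - Σ< n g
  Σ<-neg zero    = refl
  Σ<-neg (suc n) = trans (cong (_+ℤ - g n) (Σ<-neg n)) (sym (ℤ.neg-distrib-+ (Σ< n g) (g n)))

*-distribˡ-Σ< : ∀ n c (f : ℕ → ℤ) → c *ℤ Σ< n f ≡ Σ< n (λ i → c *ℤ f i)
*-distribˡ-Σ< zero    c f = ℤ.*-zeroʳ c
*-distribˡ-Σ< (suc n) c f =
  trans (ℤ.*-distribˡ-+ c (Σ< n f) (f n)) (cong (_+ℤ c *ℤ f n) (*-distribˡ-Σ< n c f))

*-distribʳ-Σ< : ∀ n c (f : ℕ → ℤ) → Σ< n f *ℤ c ≡ Σ< n (λ i → f i *ℤ c)
*-distribʳ-Σ< n c f = trans (ℤ.*-comm (Σ< n f) c)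
  (trans (*-distribˡ-Σ< n c f) (Σ<-cong n (λ i _ → ℤ.*-comm c (f i))))

Σ<-head : ∀ n (f : ℕ → ℤ) → Σ< (suc n) f ≡ f 0 +ℤ Σ< n (λ i → f (suc i))
Σ<-head zero    f = trans (ℤ.+-identityˡ (f 0)) (sym (ℤ.+-identityʳ (f 0)))
Σ<-head (suc n) f = trans (cong (_+ℤ f (suc n)) (Σ<-head n f)) (ℤ.+-assoc (f 0) _ _)

Σ<-comm : ∀ a b (G : ℕ → ℕ → ℤ) → Σ< a (λ i → Σ< b (G i)) ≡ Σ< b (λ j → Σ< a (λ i → G i j))
Σ<-comm zero    b G = sym (Σ<-zero b (λ _ _ → refl))
Σ<-comm (suc a) b G = trans (cong (_+ℤ Σ< b (G a)) (Σ<-comm a b G))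
                            (sym (Σ<-distrib-+ b (λ j → Σ< a (λ i → G i j)) (G a)))

Σ<-extend : ∀ m n {f : ℕ → ℤ} → m ≤ n → (∀ i → m ≤ i → i < n → f i ≡ 0ℤ) → Σ< m f ≡ Σ< n f
Σ<-extend m zero    z≤n      _   = refl
Σ<-extend m (suc n) {f} m≤1+n f≡0 with m ℕ.≟ suc n
... | yes refl = refl
... | no  m≢1+n = begin
    Σ< m f             ≡⟨ Σ<-extend m n m≤n (λ i m≤i i<n → f≡0 i m≤i (ℕ.m<n⇒m<1+n i<n)) ⟩
    Σ< n f             ≡⟨ sym (ℤ.+-identityʳ _) ⟩
    Σ< n f +ℤ 0ℤ       ≡⟨ cong (Σ< n f +ℤ_) (sym (f≡0 n m≤n ℕ.≤-refl)) ⟩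
    Σ< n f +ℤ f n      ∎
  where
  open ≡-Reasoning
  m≤n : m ≤ n
  m≤n = ℕ.<⇒≤pred (ℕ.≤∧≢⇒< m≤1+n m≢1+n)

Σ<-telescope : ∀ n (g : ℕ → ℤ) → Σ< n (λ i → g (suc i) -ℤ g i) ≡ g n -ℤ g 0
Σ<-telescope zero    g = sym (ℤ.+-inverseʳ (g 0))
Σ<-telescope (suc n) g = begin
    Σ< n (λ i → g (suc i) -ℤ g i) +ℤ (g (suc n) -ℤ g n)
  ≡⟨ cong (_+ℤ (g (suc n) -ℤ g n)) (Σ<-telescope n g) ⟩
    (g n -ℤ g 0) +ℤ (g (suc n) -ℤ g n)
  ≡⟨ ℤ.+-comm (g n -ℤ g 0) _ ⟩
    (g (suc n) -ℤ g n) +ℤ (g n -ℤ g 0)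
  ≡⟨ ℤ.+-minus-telescope (g (suc n)) (g n) (g 0) ⟩
    g (suc n) -ℤ g 0
  ∎
  where open ≡-Reasoning

Σ<-reverse : ∀ n (f : ℕ → ℤ) → Σ< (suc n) f ≡ Σ< (suc n) (λ i → f (n ∸ i))
Σ<-reverse zero    f = refl
Σ<-reverse (suc n) f = begin
    Σ< (suc n) f +ℤ f (suc n)
  ≡⟨ cong (_+ℤ f (suc n)) (Σ<-reverse n f) ⟩
    Σ< (suc n) (λ i → f (n ∸ i)) +ℤ f (suc n)
  ≡⟨ ℤ.+-comm _ (f (suc n)) ⟩
    f (suc n) +ℤ Σ< (suc n) (λ i → f (n ∸ i))
  ≡⟨ sym (Σ<-head (suc n) (λ i → f (suc n ∸ i))) ⟩
    Σ< (suc (suc n)) (λ i → f (suc n ∸ i))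
  ∎
  where open ≡-Reasoning

Σ<-triangle : ∀ n (G : ℕ → ℕ → ℤ) →
  Σ< n (λ i → Σ< (suc i) (G i)) ≡ Σ< n (λ j → Σ< (n ∸ j) (λ l → G (j + l) j))
Σ<-triangle zero    G = refl
Σ<-triangle (suc n) G = begin
    Σ< n (λ i → Σ< (suc i) (G i)) +ℤ (Σ< n (G n) +ℤ G n n)
  ≡⟨ cong (λ s → s +ℤ (Σ< n (G n) +ℤ G n n)) (Σ<-triangle n G) ⟩
    Σ< n rows +ℤ (Σ< n (G n) +ℤ G n n)
  ≡⟨ sym (ℤ.+-assoc (Σ< n rows) (Σ< n (G n)) (G n n)) ⟩
    (Σ< n rows +ℤ Σ< n (G n)) +ℤ G n n
  ≡⟨ cong₂ _+ℤ_ (sym (Σ<-distrib-+ n rows (G n))) last-row ⟩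
    Σ< n (λ j → rows j +ℤ G n j) +ℤ Σ< (suc n ∸ n) (λ l → G (n + l) n)
  ≡⟨ cong (_+ℤ Σ< (suc n ∸ n) (λ l → G (n + l) n)) (Σ<-cong n extend-row) ⟩
    Σ< n (λ j → Σ< (suc n ∸ j) (λ l → G (j + l) j)) +ℤ Σ< (suc n ∸ n) (λ l → G (n + l) n)
  ∎
  where
  open ≡-Reasoning
  rows : ℕ → ℤ
  rows j = Σ< (n ∸ j) (λ l → G (j + l) j)
  last-row : G n n ≡ Σ< (suc n ∸ n) (λ l → G (n + l) n)
  last-row rewrite ℕ.m+n∸n≡m 1 n | ℕ.+-identityʳ n = sym (ℤ.+-identityˡ (G n n))
  extend-row : ∀ j → j < n → rows j +ℤ G n j ≡ Σ< (suc n ∸ j) (λ l → G (j + l) j)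
  extend-row j j<n rewrite ℕ.+-∸-assoc 1 (ℕ.<⇒≤ j<n) | ℕ.m+[n∸m]≡n (ℕ.<⇒≤ j<n) = refl

-- The ring of formal power series

qpow-diag : ∀ c → qpow c c ≡ 1ℤ
qpow-diag c with c ℕ.≟ c
... | yes _   = refl
... | no  c≢c = ⊥-elim (c≢c refl)

qpow-off : ∀ {c m} → ¬ c ≡ m → qpow c m ≡ 0ℤ
qpow-off {c} {m} c≢m with c ℕ.≟ m
... | yes c≡m = ⊥-elim (c≢m c≡m)
... | no  _   = refl

Σ<-qpow-≥ : ∀ n c (h : ℕ → ℤ) → n ≤ c → Σ< n (λ i → qpow c i *ℤ h i) ≡ 0ℤ
Σ<-qpow-≥ n c h n≤c = Σ<-zero n λ i i<n →
  trans (cong (_*ℤ h i) (qpow-off (λ c≡i → ℕ.<⇒≢ (ℕ.<-≤-trans i<n n≤c) (sym c≡i)))) (ℤ.*-zeroˡ (h i))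

Σ<-qpow-< : ∀ n c (h : ℕ → ℤ) → c < n → Σ< n (λ i → qpow c i *ℤ h i) ≡ h c
Σ<-qpow-< (suc n) c h c<1+n with ℕ.m≤n⇒m<n∨m≡n (ℕ.≤-pred c<1+n)
... | inj₂ refl = begin
    Σ< c (λ i → qpow c i *ℤ h i) +ℤ qpow c c *ℤ h c
  ≡⟨ cong₂ _+ℤ_ (Σ<-qpow-≥ c c h ℕ.≤-refl) (cong (_*ℤ h c) (qpow-diag c)) ⟩
    0ℤ +ℤ 1ℤ *ℤ h c
  ≡⟨ trans (ℤ.+-identityˡ _) (ℤ.*-identityˡ _) ⟩
    h c
  ∎
  where open ≡-Reasoning
... | inj₁ c<n = begin
    Σ< n (λ i → qpow c i *ℤ h i) +ℤ qpow c n *ℤ h n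
  ≡⟨ cong₂ _+ℤ_ (Σ<-qpow-< n c h c<n) (cong (_*ℤ h n) (qpow-off (ℕ.<⇒≢ c<n))) ⟩
    h c +ℤ 0ℤ *ℤ h n
  ≡⟨ ℤ.+-identityʳ (h c) ⟩
    h c
  ∎
  where open ≡-Reasoning

qpow-⊛-≥ : ∀ {c m} f → c ≤ m → (qpow c ⊛ f) m ≡ f (m ∸ c)
qpow-⊛-≥ {c} {m} f c≤m = Σ<-qpow-< (suc m) c (λ i → f (m ∸ i)) (s≤s c≤m)

qpow-⊛-< : ∀ {c m} f → m < c → (qpow c ⊛ f) m ≡ 0ℤ
qpow-⊛-< {c} {m} f m<c = Σ<-qpow-≥ (suc m) c (λ i → f (m ∸ i)) m<c

infix 4 _≋_
record _≋_ (f g : PS) : Set where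
  constructor coeffwise
  field coeff : ∀ n → f n ≡ g n
open _≋_

0ₚ : PS
0ₚ _ = 0ℤ

⊝_ : PS → PS
(⊝ f) n = - f n

≋-refl : ∀ {f} → f ≋ f
≋-refl = coeffwise λ _ → refl

≋-sym : ∀ {f g} → f ≋ g → g ≋ f
≋-sym f≋g = coeffwise λ n → sym (coeff f≋g n)

≋-trans : ∀ {f g h} → f ≋ g → g ≋ h → f ≋ h
≋-trans f≋g g≋h = coeffwise λ n → trans (coeff f≋g n) (coeff g≋h n)

≋-reflexive : ∀ {f g} → f ≡ g → f ≋ g
≋-reflexive refl = ≋-refl

⊕-cong : ∀ {f f′ g g′} → f ≋ f′ → g ≋ g′ → f ⊕ g ≋ f′ ⊕ g′
⊕-cong f≋f′ g≋g′ = coeffwise λ n → cong₂ _+ℤ_ (coeff f≋f′ n) (coeff g≋g′ n)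

⊖-cong : ∀ {f f′ g g′} → f ≋ f′ → g ≋ g′ → f ⊖ g ≋ f′ ⊖ g′
⊖-cong f≋f′ g≋g′ = coeffwise λ n → cong₂ _-ℤ_ (coeff f≋f′ n) (coeff g≋g′ n)

⊖-congˡ : ∀ f {g g′} → g ≋ g′ → f ⊖ g ≋ f ⊖ g′
⊖-congˡ f = ⊖-cong (≋-refl {f})

⊖-congʳ : ∀ {f f′} g → f ≋ f′ → f ⊖ g ≋ f′ ⊖ g
⊖-congʳ g f≋f′ = ⊖-cong f≋f′ (≋-refl {g})

⊛-cong : ∀ {f f′ g g′} → f ≋ f′ → g ≋ g′ → f ⊛ g ≋ f′ ⊛ g′
⊛-cong f≋f′ g≋g′ = coeffwise λ n →
  Σ<-cong (suc n) (λ i _ → cong₂ _*ℤ_ (coeff f≋f′ i) (coeff g≋g′ (n ∸ i)))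

⊛-congˡ : ∀ f {g g′} → g ≋ g′ → f ⊛ g ≋ f ⊛ g′
⊛-congˡ f = ⊛-cong (≋-refl {f})

⊛-congʳ : ∀ {f f′} g → f ≋ f′ → f ⊛ g ≋ f′ ⊛ g
⊛-congʳ g f≋f′ = ⊛-cong f≋f′ (≋-refl {g})

⊛-comm : ∀ f g → f ⊛ g ≋ g ⊛ f
⊛-comm f g = coeffwise λ n → trans (Σ<-reverse n (λ i → f i *ℤ g (n ∸ i)))
  (Σ<-cong (suc n) λ i i≤n →
    trans (cong (λ j → f (n ∸ i) *ℤ g j) (ℕ.m∸[m∸n]≡n (ℕ.≤-pred i≤n))) (ℤ.*-comm (f (n ∸ i)) (g i)))

⊛-assoc : ∀ f g h → (f ⊛ g) ⊛ h ≋ f ⊛ (g ⊛ h)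
⊛-assoc f g h = coeffwise λ n → begin
    Σ< (suc n) (λ i → Σ< (suc i) (λ j → f j *ℤ g (i ∸ j)) *ℤ h (n ∸ i))
  ≡⟨ Σ<-cong (suc n) (λ i _ → *-distribʳ-Σ< (suc i) (h (n ∸ i)) (λ j → f j *ℤ g (i ∸ j))) ⟩
    Σ< (suc n) (λ i → Σ< (suc i) (λ j → f j *ℤ g (i ∸ j) *ℤ h (n ∸ i)))
  ≡⟨ Σ<-triangle (suc n) (λ i j → f j *ℤ g (i ∸ j) *ℤ h (n ∸ i)) ⟩
    Σ< (suc n) (λ j → Σ< (suc n ∸ j) (λ l → f j *ℤ g (j + l ∸ j) *ℤ h (n ∸ (j + l))))
  ≡⟨ Σ<-cong (suc n) (λ j j≤n → inner n j (ℕ.≤-pred j≤n)) ⟩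
    Σ< (suc n) (λ j → f j *ℤ Σ< (suc (n ∸ j)) (λ l → g l *ℤ h (n ∸ j ∸ l)))
  ∎
  where
  open ≡-Reasoning
  inner : ∀ n j → j ≤ n → Σ< (suc n ∸ j) (λ l → f j *ℤ g (j + l ∸ j) *ℤ h (n ∸ (j + l)))
                         ≡ f j *ℤ Σ< (suc (n ∸ j)) (λ l → g l *ℤ h (n ∸ j ∸ l))
  inner n j j≤n rewrite ℕ.+-∸-assoc 1 j≤n = trans
    (Σ<-cong (suc (n ∸ j)) λ l _ → trans
      (cong₂ (λ a b → f j *ℤ g a *ℤ h b) (ℕ.m+n∸m≡n j l) (sym (ℕ.∸-+-assoc n j l)))
      (ℤ.*-assoc (f j) (g l) (h (n ∸ j ∸ l))))
    (sym (*-distribˡ-Σ< (suc (n ∸ j)) (f j) (λ l → g l *ℤ h (n ∸ j ∸ l))))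

⊛-distribˡ-⊕ : ∀ f g h → f ⊛ (g ⊕ h) ≋ f ⊛ g ⊕ f ⊛ h
⊛-distribˡ-⊕ f g h = coeffwise λ n →
  trans (Σ<-cong (suc n) (λ i _ → ℤ.*-distribˡ-+ (f i) (g (n ∸ i)) (h (n ∸ i))))
        (Σ<-distrib-+ (suc n) (λ i → f i *ℤ g (n ∸ i)) (λ i → f i *ℤ h (n ∸ i)))

⊛-distribʳ-⊕ : ∀ h f g → (f ⊕ g) ⊛ h ≋ f ⊛ h ⊕ g ⊛ h
⊛-distribʳ-⊕ h f g = ≋-trans (⊛-comm (f ⊕ g) h)
  (≋-trans (⊛-distribˡ-⊕ h f g) (⊕-cong (⊛-comm h f) (⊛-comm h g)))

⊛-identityˡ : ∀ f → one ⊛ f ≋ f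
⊛-identityˡ f = coeffwise λ n → qpow-⊛-≥ f z≤n

⊛-identityʳ : ∀ f → f ⊛ one ≋ f
⊛-identityʳ f = ≋-trans (⊛-comm f one) (⊛-identityˡ f)

ps-isCommutativeRing : IsCommutativeRing _≋_ _⊕_ _⊛_ ⊝_ 0ₚ one
ps-isCommutativeRing = record
  { isRing = record
    { +-isAbelianGroup = record
      { isGroup = record
        { isMonoid = record
          { isSemigroup = record
            { isMagma = record
              { isEquivalence = record { refl = ≋-refl ; sym = ≋-sym ; trans = ≋-trans }
              ; ∙-cong = ⊕-cong }
            ; assoc = λ f g h → coeffwise λ n → ℤ.+-assoc (f n) (g n) (h n) }
          ; identity = (λ f → coeffwise λ n → ℤ.+-identityˡ (f n))
                     , (λ f → coeffwise λ n → ℤ.+-identityʳ (f n)) }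
        ; inverse = (λ f → coeffwise λ n → ℤ.+-inverseˡ (f n))
                  , (λ f → coeffwise λ n → ℤ.+-inverseʳ (f n))
        ; ⁻¹-cong = λ f≋g → coeffwise λ n → cong -_ (coeff f≋g n) }
      ; comm = λ f g → coeffwise λ n → ℤ.+-comm (f n) (g n) }
    ; *-cong = ⊛-cong
    ; *-assoc = ⊛-assoc
    ; *-identity = ⊛-identityˡ , ⊛-identityʳ
    ; distrib = ⊛-distribˡ-⊕ , ⊛-distribʳ-⊕ }
  ; *-comm = ⊛-comm }

ps-commutativeRing : CommutativeRing _ _
ps-commutativeRing = record { isCommutativeRing = ps-isCommutativeRing }

-- 0 and 1 are sent to 0ₚ and one on the nose, so that the solver's output
-- matches goals written with 0ₚ and one up to definitional equality.
constant : ℤ → PS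
constant (ℤ.+ 0) = 0ₚ
constant (ℤ.+ 1) = one
constant c       = λ n → c *ℤ one n

constant-coeff : ∀ c n → constant c n ≡ c *ℤ one n
constant-coeff (ℤ.+ 0)           n = sym (ℤ.*-zeroˡ (one n))
constant-coeff (ℤ.+ 1)           n = sym (ℤ.*-identityˡ (one n))
constant-coeff (ℤ.+ suc (suc _)) n = refl
constant-coeff ℤ.-[1+ _ ]        n = refl

constant-⊛ : ∀ c g → constant c ⊛ g ≋ (λ n → c *ℤ g n)
constant-⊛ c g = coeffwise λ n → begin
    Σ< (suc n) (λ i → constant c i *ℤ g (n ∸ i))
  ≡⟨ Σ<-cong (suc n) (λ i _ → trans (cong (_*ℤ g (n ∸ i)) (constant-coeff c i))
                                    (ℤ.*-assoc c (one i) (g (n ∸ i)))) ⟩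
    Σ< (suc n) (λ i → c *ℤ (one i *ℤ g (n ∸ i)))
  ≡⟨ sym (*-distribˡ-Σ< (suc n) c _) ⟩
    c *ℤ (one ⊛ g) n
  ≡⟨ cong (c *ℤ_) (coeff (⊛-identityˡ g) n) ⟩
    c *ℤ g n
  ∎
  where open ≡-Reasoning

constant-morphism : ℤ.+-*-rawRing -Raw-AlmostCommutative⟶ fromCommutativeRing ps-commutativeRing
constant-morphism = record
  { ⟦_⟧    = constant
  ; +-homo = λ a b → coeffwise λ n → begin
      constant (a +ℤ b) n                ≡⟨ constant-coeff (a +ℤ b) n ⟩
      (a +ℤ b) *ℤ one n                  ≡⟨ ℤ.*-distribʳ-+ (one n) a b ⟩
      a *ℤ one n +ℤ b *ℤ one n           ≡⟨ sym (cong₂ _+ℤ_ (constant-coeff a n) (constant-coeff b n)) ⟩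
      constant a n +ℤ constant b n       ∎
  ; *-homo = λ a b → coeffwise λ n → begin
      constant (a *ℤ b) n                ≡⟨ constant-coeff (a *ℤ b) n ⟩
      a *ℤ b *ℤ one n                    ≡⟨ ℤ.*-assoc a b (one n) ⟩
      a *ℤ (b *ℤ one n)                  ≡⟨ cong (a *ℤ_) (sym (constant-coeff b n)) ⟩
      a *ℤ constant b n                  ≡⟨ sym (coeff (constant-⊛ a (constant b)) n) ⟩
      (constant a ⊛ constant b) n        ∎
  ; -‿homo = λ a → coeffwise λ n → begin
      constant (- a) n                   ≡⟨ constant-coeff (- a) n ⟩
      - a *ℤ one n                       ≡⟨ sym (ℤ.neg-distribˡ-* a (one n)) ⟩
      - (a *ℤ one n)                     ≡⟨ cong -_ (sym (constant-coeff a n)) ⟩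
      - constant a n                     ∎
  ; 0-homo = ≋-refl
  ; 1-homo = ≋-refl
  }
  where open ≡-Reasoning

constant-≟ : ∀ a b → Maybe (constant a ≋ constant b)
constant-≟ a b with a ℤ.≟ b
... | yes refl = just ≋-refl
... | no  _    = nothing

module PS-Solver =
  Algebra.Solver.Ring ℤ.+-*-rawRing (fromCommutativeRing ps-commutativeRing) constant-morphism constant-≟
module PS-MonoidSolver = Algebra.Solver.CommutativeMonoid (CommutativeRing.*-commutativeMonoid ps-commutativeRing)
module ≋-Reasoning = Relation.Binary.Reasoning.Setoid (CommutativeRing.setoid ps-commutativeRing)
open PS-Solver using (_:+_; _:*_; _:-_; _:=_; con)
open PS-MonoidSolver using (_⊜_) renaming (_⊕_ to _∙_)

infix 4 _≡_mod-q^_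
record _≡_mod-q^_ (f g : PS) (N : ℕ) : Set where
  constructor agree-below
  field coeff< : ∀ {m} → m < N → f m ≡ g m
open _≡_mod-q^_

≋⇒≡-mod : ∀ {f g} N → f ≋ g → f ≡ g mod-q^ N
≋⇒≡-mod N f≋g = agree-below λ {m} _ → coeff f≋g m

≡-mod-sym : ∀ {f g N} → f ≡ g mod-q^ N → g ≡ f mod-q^ N
≡-mod-sym f≡g = agree-below λ m<N → sym (coeff< f≡g m<N)

≡-mod-trans : ∀ {f g h N} → f ≡ g mod-q^ N → g ≡ h mod-q^ N → f ≡ h mod-q^ N
≡-mod-trans f≡g g≡h = agree-below λ m<N → trans (coeff< f≡g m<N) (coeff< g≡h m<N)

≡-mod-weaken : ∀ {f g M N} → M ≤ N → f ≡ g mod-q^ N → f ≡ g mod-q^ M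
≡-mod-weaken M≤N f≡g = agree-below λ m<M → coeff< f≡g (ℕ.<-≤-trans m<M M≤N)

≡-mod-setoid : ℕ → Setoid _ _
≡-mod-setoid N = record
  { Carrier       = PS
  ; _≈_           = λ f g → f ≡ g mod-q^ N
  ; isEquivalence = record { refl = ≋⇒≡-mod N ≋-refl ; sym = ≡-mod-sym ; trans = ≡-mod-trans } }

module ≡-mod-Reasoning N = Relation.Binary.Reasoning.Setoid (≡-mod-setoid N)

≡-mod-all⇒≋ : ∀ {f g} → (∀ N → f ≡ g mod-q^ N) → f ≋ g
≡-mod-all⇒≋ f≡g = coeffwise λ n → coeff< (f≡g (suc n)) ℕ.≤-refl

⊛-cong-mod : ∀ {f f′ g g′ N} → f ≡ f′ mod-q^ N → g ≡ g′ mod-q^ N → f ⊛ g ≡ f′ ⊛ g′ mod-q^ N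
⊛-cong-mod f≡f′ g≡g′ = agree-below λ {n} n<N → Σ<-cong (suc n) λ i i≤n →
  cong₂ _*ℤ_ (coeff< f≡f′ (ℕ.<-≤-trans i≤n n<N)) (coeff< g≡g′ (ℕ.≤-<-trans (ℕ.m∸n≤m n i) n<N))

order-⊛ : ∀ {f g} a b → f ≡ 0ₚ mod-q^ a → g ≡ 0ₚ mod-q^ b → f ⊛ g ≡ 0ₚ mod-q^ (a + b)
order-⊛ {f} {g} a b f≡0 g≡0 = agree-below λ {m} m<a+b →
  Σ<-zero (suc m) λ i i≤m → term-zero m<a+b (ℕ.≤-pred i≤m)
  where
  term-zero : ∀ {m i} → m < a + b → i ≤ m → f i *ℤ g (m ∸ i) ≡ 0ℤ
  term-zero {m} {i} m<a+b i≤m with i <? a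
  ... | yes i<a = trans (cong (_*ℤ g (m ∸ i)) (coeff< f≡0 i<a)) (ℤ.*-zeroˡ (g (m ∸ i)))
  ... | no  i≮a = trans (cong (f i *ℤ_) (coeff< g≡0 m∸i<b)) (ℤ.*-zeroʳ (f i))
    where
    m∸i<b : m ∸ i < b
    m∸i<b = ℕ.+-cancelˡ-< i (m ∸ i) b (ℕ.<-≤-trans
      (subst (_< a + b) (sym (ℕ.m+[n∸m]≡n i≤m)) m<a+b) (ℕ.+-monoˡ-≤ b (ℕ.≮⇒≥ i≮a)))

order-⊛ˡ : ∀ {f} g a → f ≡ 0ₚ mod-q^ a → f ⊛ g ≡ 0ₚ mod-q^ a
order-⊛ˡ {f} g a f≡0 = subst (λ N → f ⊛ g ≡ 0ₚ mod-q^ N) (ℕ.+-identityʳ a)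
  (order-⊛ {f} {g} a 0 f≡0 (agree-below λ ()))

order-⊛ʳ : ∀ f {g} b → g ≡ 0ₚ mod-q^ b → f ⊛ g ≡ 0ₚ mod-q^ b
order-⊛ʳ f {g} b g≡0 = ≡-mod-trans (≋⇒≡-mod b (⊛-comm f g)) (order-⊛ˡ f b g≡0)

qpow-order : ∀ c → qpow c ≡ 0ₚ mod-q^ c
qpow-order c = agree-below λ m<c → qpow-off (λ c≡m → ℕ.<⇒≢ m<c (sym c≡m))

qpow-+ : ∀ a b → qpow a ⊛ qpow b ≋ qpow (a + b)
qpow-+ a b = coeffwise λ m → by-cases m (a ≤? m) (a + b ℕ.≟ m)
  where
  by-cases : ∀ m → Dec (a ≤ m) → Dec (a + b ≡ m) → (qpow a ⊛ qpow b) m ≡ qpow (a + b) m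
  by-cases m (no a≰m) _ = trans (qpow-⊛-< (qpow b) (ℕ.≰⇒> a≰m))
    (sym (qpow-off (λ a+b≡m → a≰m (subst (a ≤_) a+b≡m (ℕ.m≤m+n a b)))))
  by-cases m (yes a≤m) (yes refl) = trans (qpow-⊛-≥ (qpow b) a≤m)
    (trans (cong (qpow b) (ℕ.m+n∸m≡n a b)) (trans (qpow-diag b) (sym (qpow-diag (a + b)))))
  by-cases m (yes a≤m) (no a+b≢m) = trans (qpow-⊛-≥ (qpow b) a≤m)
    (trans (qpow-off (λ b≡m∸a → a+b≢m (trans (cong (a +_) b≡m∸a) (ℕ.m+[n∸m]≡n a≤m))))
           (sym (qpow-off a+b≢m)))

qpow-quotient : ∀ c {f} g → f ≡ qpow c ⊛ g mod-q^ suc c →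
  Σ PS λ e → (e 0 ≡ g 0) × (f ≋ qpow c ⊛ e)
qpow-quotient c {f} g f≡q^cg = (λ n → f (n + c)) , leading , factorisation
  where
  leading : f c ≡ g 0
  leading = trans (coeff< f≡q^cg ℕ.≤-refl) (trans (qpow-⊛-≥ g (ℕ.≤-refl {c})) (cong g (ℕ.n∸n≡0 c)))
  factorisation : f ≋ qpow c ⊛ (λ n → f (n + c))
  factorisation = coeffwise λ m → by-cases m (c ≤? m)
    where
    by-cases : ∀ m → Dec (c ≤ m) → f m ≡ (qpow c ⊛ (λ n → f (n + c))) m
    by-cases m (yes c≤m) = sym (trans (qpow-⊛-≥ (λ n → f (n + c)) c≤m) (cong f (ℕ.m∸n+n≡m c≤m)))
    by-cases m (no  c≰m) = trans (coeff< f≡q^cg (ℕ.m<n⇒m<1+n m<c))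
      (trans (qpow-⊛-< g m<c) (sym (qpow-⊛-< (λ n → f (n + c)) m<c)))
      where m<c = ℕ.≰⇒> c≰m

-- Infinite products and sums

one-pos : ∀ {m} → 0 < m → one m ≡ 0ℤ
one-pos {suc m} _ = qpow-off {0} {suc m} (λ ())

oneMinusQ-≡-one : ∀ a → oneMinusQ a ≡ one mod-q^ a
oneMinusQ-≡-one a = agree-below λ {m} m<a →
  trans (cong (one m -ℤ_) (coeff< (qpow-order a) m<a)) (ℤ.+-identityʳ (one m))

geom-multiple : ∀ a {m} → a ∣ m → geom a m ≡ 1ℤ
geom-multiple a {m} a∣m with a ∣? m
... | yes _   = refl
... | no  a∤m = ⊥-elim (a∤m a∣m)

geom-non-multiple : ∀ a {m} → ¬ a ∣ m → geom a m ≡ 0ℤ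
geom-non-multiple a {m} a∤m with a ∣? m
... | yes a∣m = ⊥-elim (a∤m a∣m)
... | no  _   = refl

geom-periodic : ∀ a {m} → a ≤ m → geom a m ≡ geom a (m ∸ a)
geom-periodic a {m} a≤m with a ∣? (m ∸ a)
... | yes a∣m∸a = geom-multiple a (∣m∸n∣n⇒∣m a a≤m a∣m∸a ∣-refl)
... | no  a∤m∸a = geom-non-multiple a λ a∣m →
  a∤m∸a (∣m+n∣m⇒∣n (subst (a ∣_) (sym (ℕ.m+[n∸m]≡n a≤m)) a∣m) ∣-refl)

geom-≡-one : ∀ a → geom a ≡ one mod-q^ a
geom-≡-one a = agree-below low-coeff
  where
  low-coeff : ∀ {m} → m < a → geom a m ≡ one m
  low-coeff {zero}  _     = geom-multiple a (a ∣0)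
  low-coeff {suc m} 1+m<a =
    trans (geom-non-multiple a (λ a∣1+m → ℕ.<⇒≱ 1+m<a (∣⇒≤ a∣1+m))) (sym (one-pos {suc m} (s≤s z≤n)))

geom-inverse : ∀ a → 1 ≤ a → geom a ⊛ oneMinusQ a ≋ one
geom-inverse a 1≤a = ≋-trans
  (PS-Solver.solve 2 (λ g x → g :* (con 1ℤ :- x) := g :- x :* g) ≋-refl (geom a) (qpow a))
  (coeffwise λ m → by-cases m (a ≤? m))
  where
  by-cases : ∀ m → Dec (a ≤ m) → geom a m -ℤ (qpow a ⊛ geom a) m ≡ one m
  by-cases m (yes a≤m) = begin
    geom a m -ℤ (qpow a ⊛ geom a) m   ≡⟨ cong₂ _-ℤ_ (geom-periodic a a≤m) (qpow-⊛-≥ (geom a) a≤m) ⟩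
    geom a (m ∸ a) -ℤ geom a (m ∸ a)  ≡⟨ ℤ.+-inverseʳ (geom a (m ∸ a)) ⟩
    0ℤ                                ≡⟨ sym (one-pos (ℕ.<-≤-trans 1≤a a≤m)) ⟩
    one m                             ∎
    where open ≡-Reasoning
  by-cases m (no a≰m) = begin
    geom a m -ℤ (qpow a ⊛ geom a) m   ≡⟨ cong (geom a m -ℤ_) (qpow-⊛-< (geom a) (ℕ.≰⇒> a≰m)) ⟩
    geom a m -ℤ 0ℤ                    ≡⟨ ℤ.+-identityʳ (geom a m) ⟩
    geom a m                          ≡⟨ coeff< (geom-≡-one a) (ℕ.≰⇒> a≰m) ⟩
    one m                             ∎
    where open ≡-Reasoning

∏∞ : (ℕ → PS) → PS
∏∞ u m = prodTo (suc m) u m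

Multipliable : (ℕ → PS) → Set
Multipliable u = ∀ j → u j ≡ one mod-q^ suc j

prodTo-cong : ∀ n {u v : ℕ → PS} → (∀ j → u j ≋ v j) → prodTo n u ≋ prodTo n v
prodTo-cong zero    u≋v = ≋-refl
prodTo-cong (suc n) u≋v = ⊛-cong (prodTo-cong n u≋v) (u≋v n)

prodTo-uncons : ∀ n (u : ℕ → PS) → prodTo (suc n) u ≋ u 0 ⊛ prodTo n (λ j → u (suc j))
prodTo-uncons zero    u = ⊛-comm one (u 0)
prodTo-uncons (suc n) u = ≋-trans (⊛-congʳ (u (suc n)) (prodTo-uncons n u))
                                  (⊛-assoc (u 0) (prodTo n (λ j → u (suc j))) (u (suc n)))

⊛-≡-one : ∀ {f g N} → f ≡ one mod-q^ N → g ≡ one mod-q^ N → f ⊛ g ≡ one mod-q^ N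
⊛-≡-one {N = N} f≡one g≡one = ≡-mod-trans (⊛-cong-mod f≡one g≡one) (≋⇒≡-mod N (⊛-identityˡ one))

prodTo-≡-one : ∀ n N (u : ℕ → PS) → (∀ j → u j ≡ one mod-q^ N) → prodTo n u ≡ one mod-q^ N
prodTo-≡-one zero    N u u≡one = ≋⇒≡-mod N ≋-refl
prodTo-≡-one (suc n) N u u≡one = ⊛-≡-one (prodTo-≡-one n N u u≡one) (u≡one n)

prodTo-stable : ∀ u → Multipliable u → ∀ {x n} → x ≤ n → prodTo n u ≡ prodTo x u mod-q^ suc x
prodTo-stable u mult {x} {zero}  z≤n = ≋⇒≡-mod 1 ≋-refl
prodTo-stable u mult {x} {suc n} x≤1+n with ℕ.m≤n⇒m<n∨m≡n x≤1+n
... | inj₂ refl  = ≋⇒≡-mod (suc x) ≋-refl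
... | inj₁ x<1+n = ≡-mod-trans
  (⊛-cong-mod (prodTo-stable u mult (ℕ.≤-pred x<1+n)) (≡-mod-weaken x<1+n (mult n)))
  (≋⇒≡-mod (suc x) (⊛-identityʳ (prodTo x u)))

∏∞-coeff : ∀ u → Multipliable u → ∀ {x n} → x ≤ n → prodTo n u x ≡ ∏∞ u x
∏∞-coeff u mult {x} x≤n = trans (coeff< (prodTo-stable u mult x≤n) ℕ.≤-refl)
                                 (sym (coeff< (prodTo-stable u mult (ℕ.n≤1+n x)) ℕ.≤-refl))

∏∞-cong : ∀ {u v : ℕ → PS} → (∀ j → u j ≋ v j) → ∏∞ u ≋ ∏∞ v
∏∞-cong u≋v = coeffwise λ m → coeff (prodTo-cong (suc m) u≋v) m

∏∞-≡-one : ∀ N (u : ℕ → PS) → (∀ j → u j ≡ one mod-q^ N) → ∏∞ u ≡ one mod-q^ N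
∏∞-≡-one N u u≡one = agree-below λ {m} → coeff< (prodTo-≡-one (suc m) N u u≡one)

∏∞-uncons : ∀ u → Multipliable (λ j → u (suc j)) → ∏∞ u ≋ u 0 ⊛ ∏∞ (λ j → u (suc j))
∏∞-uncons u mult = coeffwise λ m → trans (coeff (prodTo-uncons m u) m)
  (Σ<-cong (suc m) λ i i≤m → cong (u 0 i *ℤ_) (∏∞-coeff (λ j → u (suc j)) mult (ℕ.m∸n≤m m i)))

Summable : (ℕ → PS) → Set
Summable T = ∀ n → T n ≡ 0ₚ mod-q^ n

sumInf-cong : ∀ {T U : ℕ → PS} → (∀ n → T n ≋ U n) → sumInf T ≋ sumInf U
sumInf-cong T≋U = coeffwise λ m → Σ<-cong (suc m) λ n _ → coeff (T≋U n) m

sumInf-⊖ : ∀ (T U : ℕ → PS) → sumInf (λ n → T n ⊖ U n) ≋ sumInf T ⊖ sumInf U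
sumInf-⊖ T U = coeffwise λ m → Σ<-distrib-minus (suc m) (λ n → T n m) (λ n → U n m)

⊛-sumInf : ∀ f (T : ℕ → PS) → Summable T → f ⊛ sumInf T ≋ sumInf (λ n → f ⊛ T n)
⊛-sumInf f T summable = coeffwise λ m → begin
    Σ< (suc m) (λ i → f i *ℤ Σ< (suc (m ∸ i)) (λ n → T n (m ∸ i)))
  ≡⟨ Σ<-cong (suc m) (λ i _ → cong (f i *ℤ_) (Σ<-extend (suc (m ∸ i)) (suc m) (s≤s (ℕ.m∸n≤m m i))
       (λ n m∸i<n _ → coeff< (summable n) m∸i<n))) ⟩
    Σ< (suc m) (λ i → f i *ℤ Σ< (suc m) (λ n → T n (m ∸ i)))
  ≡⟨ Σ<-cong (suc m) (λ i _ → *-distribˡ-Σ< (suc m) (f i) (λ n → T n (m ∸ i))) ⟩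
    Σ< (suc m) (λ i → Σ< (suc m) (λ n → f i *ℤ T n (m ∸ i)))
  ≡⟨ Σ<-comm (suc m) (suc m) (λ i n → f i *ℤ T n (m ∸ i)) ⟩
    Σ< (suc m) (λ n → Σ< (suc m) (λ i → f i *ℤ T n (m ∸ i)))
  ∎
  where open ≡-Reasoning

sumInf-≡-head : ∀ N (T : ℕ → PS) → (∀ n → T (suc n) ≡ 0ₚ mod-q^ N) → sumInf T ≡ T 0 mod-q^ N
sumInf-≡-head N T tail≡0 = agree-below λ {m} m<N → begin
  Σ< (suc m) (λ n → T n m)            ≡⟨ Σ<-head m (λ n → T n m) ⟩
  T 0 m +ℤ Σ< m (λ n → T (suc n) m)   ≡⟨ cong (T 0 m +ℤ_) (Σ<-zero m (λ n _ → coeff< (tail≡0 n) m<N)) ⟩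
  T 0 m +ℤ 0ℤ                         ≡⟨ ℤ.+-identityʳ (T 0 m) ⟩
  T 0 m                               ∎
  where open ≡-Reasoning

sumInf-uncons : ∀ (T : ℕ → PS) → Summable T → sumInf T ≋ T 0 ⊕ sumInf (λ n → T (suc n))
sumInf-uncons T summable = coeffwise λ m → begin
  Σ< (suc m) (λ n → T n m)                    ≡⟨ Σ<-head m (λ n → T n m) ⟩
  T 0 m +ℤ Σ< m (λ n → T (suc n) m)           ≡⟨ cong (T 0 m +ℤ_) (sym (ℤ.+-identityʳ _)) ⟩
  T 0 m +ℤ (Σ< m (λ n → T (suc n) m) +ℤ 0ℤ)   ≡⟨ cong (λ t → T 0 m +ℤ (Σ< m (λ n → T (suc n) m) +ℤ t))
                                                     (sym (coeff< (summable (suc m)) ℕ.≤-refl)) ⟩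
  T 0 m +ℤ Σ< (suc m) (λ n → T (suc n) m)     ∎
  where open ≡-Reasoning

sumInf-telescope : ∀ (V : ℕ → PS) → sumInf (λ n → V (suc n) ⊖ V n) ≋ (λ m → V (suc m) m) ⊖ V 0
sumInf-telescope V = coeffwise λ m → Σ<-telescope (suc m) (λ n → V n m)

module _ (u : ℕ → PS) (u≡one : ∀ a → u a ≡ one mod-q^ a) where

  progression-≡-one : ∀ b d → ∏∞ (λ j → u (b + j * d)) ≡ one mod-q^ b
  progression-≡-one b d = ∏∞-≡-one b _ λ j → ≡-mod-weaken (ℕ.m≤m+n b (j * d)) (u≡one (b + j * d))

  progression-uncons : ∀ b d → .{{ℕ.NonZero d}} →
    ∏∞ (λ j → u (b + j * d)) ≋ u b ⊛ ∏∞ (λ j → u (b + d + j * d))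
  progression-uncons b d = ≋-trans (∏∞-uncons (λ j → u (b + j * d)) multipliable)
    (⊛-cong (≋-reflexive (cong u (ℕ.+-identityʳ b)))
            (∏∞-cong λ j → ≋-reflexive (cong u (sym (ℕ.+-assoc b d (j * d))))))
    where
    multipliable : Multipliable (λ j → u (b + suc j * d))
    multipliable j = ≡-mod-weaken (ℕ.≤-trans (ℕ.m≤m*n (suc j) d) (ℕ.m≤n+m (suc j * d) b))
                                  (u≡one (b + suc j * d))

P : ℕ → PS
P b = pochInf b 2

P⁻¹ : ℕ → PS
P⁻¹ b = invPochInf b 2

P-≡-one : ∀ b → P b ≡ one mod-q^ b
P-≡-one b = progression-≡-one oneMinusQ oneMinusQ-≡-one b 2

P⁻¹-≡-one : ∀ b → P⁻¹ b ≡ one mod-q^ b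
P⁻¹-≡-one b = progression-≡-one geom geom-≡-one b 2

P-uncons : ∀ b → P b ≋ oneMinusQ b ⊛ P (b + 2)
P-uncons b = progression-uncons oneMinusQ oneMinusQ-≡-one b 2

P-zero : P 0 ≋ 0ₚ
P-zero = ≋-trans (P-uncons 0) (≋-trans (⊛-congʳ (P 2) (coeffwise λ n → ℤ.+-inverseʳ (one n)))
                                       (CommutativeRing.zeroˡ ps-commutativeRing (P 2)))

P⁻¹-step : ∀ b → 1 ≤ b → P⁻¹ (b + 2) ≋ P⁻¹ b ⊛ oneMinusQ b
P⁻¹-step b 1≤b = begin
    P⁻¹ (b + 2)
  ≈⟨ ≋-sym (⊛-identityˡ (P⁻¹ (b + 2))) ⟩
    one ⊛ P⁻¹ (b + 2)
  ≈⟨ ⊛-congʳ (P⁻¹ (b + 2)) (≋-sym (geom-inverse b 1≤b)) ⟩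
    geom b ⊛ oneMinusQ b ⊛ P⁻¹ (b + 2)
  ≈⟨ PS-MonoidSolver.solve 3 (λ g u p → (g ∙ u) ∙ p ⊜ (g ∙ p) ∙ u) ≋-refl (geom b) (oneMinusQ b) (P⁻¹ (b + 2)) ⟩
    geom b ⊛ P⁻¹ (b + 2) ⊛ oneMinusQ b
  ≈⟨ ⊛-congʳ (oneMinusQ b) (≋-sym (progression-uncons geom geom-≡-one b 2)) ⟩
    P⁻¹ b ⊛ oneMinusQ b
  ∎
  where open ≋-Reasoning

-- The recurrence for Φ(α, β)

P⁻¹-next : ∀ n γ → 1 ≤ γ → P⁻¹ (2 * suc n + γ) ≋ P⁻¹ (2 * n + γ) ⊛ (one ⊖ qpow (2 * n) ⊛ qpow γ)
P⁻¹-next n γ 1≤γ = begin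
    P⁻¹ (2 * suc n + γ)
  ≡⟨ cong P⁻¹ (index n γ) ⟩
    P⁻¹ (2 * n + γ + 2)
  ≈⟨ P⁻¹-step (2 * n + γ) (ℕ.≤-trans 1≤γ (ℕ.m≤n+m γ (2 * n))) ⟩
    P⁻¹ (2 * n + γ) ⊛ oneMinusQ (2 * n + γ)
  ≈⟨ ⊛-congˡ (P⁻¹ (2 * n + γ)) (⊖-congˡ one (≋-sym (qpow-+ (2 * n) γ))) ⟩
    P⁻¹ (2 * n + γ) ⊛ (one ⊖ qpow (2 * n) ⊛ qpow γ)
  ∎
  where
  open ≋-Reasoning
  index : ∀ n γ → 2 * suc n + γ ≡ 2 * n + γ + 2
  index = solve-∀

φ : ℕ → ℕ → ℕ → PS
φ α β n = qpow (2 * n) ⊛ P (2 * n + 2) ⊛ P⁻¹ (2 * n + α) ⊛ P⁻¹ (2 * n + β)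

Φ : ℕ → ℕ → PS
Φ α β = sumInf (φ α β)

φ-summable : ∀ α β → Summable (φ α β)
φ-summable α β n =
  order-⊛ˡ (P⁻¹ (2 * n + β)) n (order-⊛ˡ (P⁻¹ (2 * n + α)) n (order-⊛ˡ (P (2 * n + 2)) n
    (≡-mod-weaken (ℕ.m≤m+n n (n + 0)) (qpow-order (2 * n)))))

Φ-symmetric : ∀ α β → Φ α β ≋ Φ β α
Φ-symmetric α β = sumInf-cong λ n →
  PS-MonoidSolver.solve 4 (λ q p a b → ((q ∙ p) ∙ a) ∙ b ⊜ ((q ∙ p) ∙ b) ∙ a) ≋-refl
    (qpow (2 * n)) (P (2 * n + 2)) (P⁻¹ (2 * n + α)) (P⁻¹ (2 * n + β))

V : ℕ → ℕ → ℕ → PS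
V α β n = P (2 * n) ⊛ P⁻¹ (2 * n + α) ⊛ P⁻¹ (2 * n + β)

V-zero : ∀ α β → V α β 0 ≋ 0ₚ
V-zero α β = ≋-trans (⊛-congʳ (P⁻¹ β) (⊛-congʳ (P⁻¹ α) P-zero))
  (PS-Solver.solve 2 (λ x y → con 0ℤ :* x :* y := con 0ℤ) ≋-refl (P⁻¹ α) (P⁻¹ β))

V-diagonal : ∀ α β m → V α β (suc m) m ≡ one m
V-diagonal α β m = coeff< (⊛-≡-one (⊛-≡-one
  (≡-mod-weaken 1+m≤2+2m (P-≡-one (2 * suc m)))
  (≡-mod-weaken (ℕ.≤-trans 1+m≤2+2m (ℕ.m≤m+n _ α)) (P⁻¹-≡-one (2 * suc m + α))))
  (≡-mod-weaken (ℕ.≤-trans 1+m≤2+2m (ℕ.m≤m+n _ β)) (P⁻¹-≡-one (2 * suc m + β)))) ℕ.≤-refl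
  where
  1+m≤2+2m : suc m ≤ 2 * suc m
  1+m≤2+2m = ℕ.m≤m+n (suc m) (suc m + 0)

φ-telescopes : ∀ α β n → 1 ≤ α → 1 ≤ β →
  oneMinusQ α ⊛ φ α β n ⊖ qpow β ⊛ φ (α + 2) β n ≋ V α β (suc n) ⊖ V α β n
φ-telescopes α β n 1≤α 1≤β = begin
    oneMinusQ α ⊛ φ α β n ⊖ qpow β ⊛ φ (α + 2) β n
  ≈⟨ ⊖-congˡ (oneMinusQ α ⊛ φ α β n) (⊛-congˡ B (⊛-congʳ y (⊛-congˡ (Q ⊛ p) x-next))) ⟩
    (one ⊖ A) ⊛ (Q ⊛ p ⊛ x ⊛ y) ⊖ B ⊛ (Q ⊛ p ⊛ (x ⊛ (one ⊖ Q ⊛ A)) ⊛ y)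
  ≈⟨ PS-Solver.solve 6 (λ A B Q p x y →
         (con 1ℤ :- A) :* (Q :* p :* x :* y) :- B :* (Q :* p :* (x :* (con 1ℤ :- Q :* A)) :* y)
      := p :* (x :* (con 1ℤ :- Q :* A)) :* (y :* (con 1ℤ :- Q :* B)) :- (con 1ℤ :- Q) :* p :* x :* y)
      ≋-refl A B Q p x y ⟩
    p ⊛ (x ⊛ (one ⊖ Q ⊛ A)) ⊛ (y ⊛ (one ⊖ Q ⊛ B)) ⊖ (one ⊖ Q) ⊛ p ⊛ x ⊛ y
  ≈⟨ ⊖-cong (≋-sym (⊛-cong (⊛-cong (≋-reflexive (cong P (double-suc n))) (P⁻¹-next n α 1≤α))
                            (P⁻¹-next n β 1≤β)))
            (≋-sym (⊛-congʳ y (⊛-congʳ x (P-uncons (2 * n))))) ⟩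
    V α β (suc n) ⊖ V α β n
  ∎
  where
  open ≋-Reasoning
  A = qpow α
  B = qpow β
  Q = qpow (2 * n)
  p = P (2 * n + 2)
  x = P⁻¹ (2 * n + α)
  y = P⁻¹ (2 * n + β)
  index : ∀ n γ → 2 * suc n + γ ≡ 2 * n + (γ + 2)
  index = solve-∀
  double-suc : ∀ n → 2 * suc n ≡ 2 * n + 2
  double-suc = solve-∀
  x-next : P⁻¹ (2 * n + (α + 2)) ≋ x ⊛ (one ⊖ Q ⊛ A)
  x-next = ≋-trans (≋-reflexive (cong P⁻¹ (sym (index n α)))) (P⁻¹-next n α 1≤α)

Φ-recurrence : ∀ α β → 1 ≤ α → 1 ≤ β → oneMinusQ α ⊛ Φ α β ⊖ qpow β ⊛ Φ (α + 2) β ≋ one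
Φ-recurrence α β 1≤α 1≤β = begin
    oneMinusQ α ⊛ Φ α β ⊖ qpow β ⊛ Φ (α + 2) β
  ≈⟨ ⊖-cong (⊛-sumInf (oneMinusQ α) (φ α β) (φ-summable α β))
            (⊛-sumInf (qpow β) (φ (α + 2) β) (φ-summable (α + 2) β)) ⟩
    sumInf (λ n → oneMinusQ α ⊛ φ α β n) ⊖ sumInf (λ n → qpow β ⊛ φ (α + 2) β n)
  ≈⟨ ≋-sym (sumInf-⊖ (λ n → oneMinusQ α ⊛ φ α β n) (λ n → qpow β ⊛ φ (α + 2) β n)) ⟩
    sumInf (λ n → oneMinusQ α ⊛ φ α β n ⊖ qpow β ⊛ φ (α + 2) β n)
  ≈⟨ sumInf-cong (λ n → φ-telescopes α β n 1≤α 1≤β) ⟩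
    sumInf (λ n → V α β (suc n) ⊖ V α β n)
  ≈⟨ sumInf-telescope (V α β) ⟩
    (λ m → V α β (suc m) m) ⊖ V α β 0
  ≈⟨ ⊖-cong (coeffwise (V-diagonal α β)) (V-zero α β) ⟩
    one ⊖ 0ₚ
  ≈⟨ coeffwise (λ m → ℤ.+-identityʳ (one m)) ⟩
    one
  ∎
  where open ≋-Reasoning

Φ-diagonal-recurrence : ∀ α → 1 ≤ α →
  oneMinusQ α ⊛ oneMinusQ α ⊛ Φ α α ≋ one ⊕ qpow α ⊛ qpow (α + 2) ⊛ Φ (α + 2) (α + 2)
Φ-diagonal-recurrence α 1≤α =
  eliminate (qpow α) (qpow α) (qpow (α + 2)) (Φ α α) (Φ (α + 2) α) (Φ (α + 2) (α + 2))
    (Φ-recurrence α α 1≤α 1≤α)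
    (≋-trans (⊖-congʳ (qpow (α + 2) ⊛ Φ (α + 2) (α + 2)) (⊛-congˡ (oneMinusQ α) (Φ-symmetric (α + 2) α)))
             (Φ-recurrence α (α + 2) 1≤α (ℕ.≤-trans 1≤α (ℕ.m≤m+n α 2))))
  where
  eliminate : ∀ a b c X Y Z → (one ⊖ a) ⊛ X ⊖ b ⊛ Y ≋ one → (one ⊖ b) ⊛ Y ⊖ c ⊛ Z ≋ one →
              (one ⊖ a) ⊛ (one ⊖ b) ⊛ X ≋ one ⊕ b ⊛ c ⊛ Z
  eliminate a b c X Y Z e₁ e₂ = begin
      (one ⊖ a) ⊛ (one ⊖ b) ⊛ X
    ≈⟨ PS-Solver.solve 6 (λ a b c X Y Z → (con 1ℤ :- a) :* (con 1ℤ :- b) :* X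
          := (con 1ℤ :- b) :* ((con 1ℤ :- a) :* X :- b :* Y) :+ b :* ((con 1ℤ :- b) :* Y :- c :* Z)
             :+ b :* c :* Z)
          ≋-refl a b c X Y Z ⟩
      (one ⊖ b) ⊛ ((one ⊖ a) ⊛ X ⊖ b ⊛ Y) ⊕ b ⊛ ((one ⊖ b) ⊛ Y ⊖ c ⊛ Z) ⊕ b ⊛ c ⊛ Z
    ≈⟨ ⊕-cong (⊕-cong (⊛-congˡ (one ⊖ b) e₁) (⊛-congˡ b e₂)) (≋-refl {b ⊛ c ⊛ Z}) ⟩
      (one ⊖ b) ⊛ one ⊕ b ⊛ one ⊕ b ⊛ c ⊛ Z
    ≈⟨ PS-Solver.solve 3 (λ b c Z → (con 1ℤ :- b) :* con 1ℤ :+ b :* con 1ℤ :+ b :* c :* Z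
                                  := con 1ℤ :+ b :* c :* Z) ≋-refl b c Z ⟩
      one ⊕ b ⊛ c ⊛ Z
    ∎
    where open ≋-Reasoning

-- The recurrence for R(α), and Φ(1, 1) = ω

ρ : ℕ → ℕ → PS
ρ α n = qpow (2 * n * (n + α)) ⊛ invPoch α 2 (suc n) ⊛ invPoch α 2 (suc n)

R : ℕ → PS
R α = sumInf (ρ α)

ρ-summable : ∀ α → 1 ≤ α → Summable (ρ α)
ρ-summable α 1≤α n = order-⊛ˡ (invPoch α 2 (suc n)) n (order-⊛ˡ (invPoch α 2 (suc n)) n
  (≡-mod-weaken n≤exponent (qpow-order (2 * n * (n + α)))))
  where
  n≤exponent : n ≤ 2 * n * (n + α)
  n≤exponent = ℕ.≤-trans (ℕ.m≤m+n n (n + 0)) (ℕ.m≤m*n (2 * n) (n + α)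
    {{ℕ.>-nonZero (ℕ.≤-trans 1≤α (ℕ.m≤n+m α n))}})

invPoch-uncons : ∀ α n → invPoch α 2 (suc (suc n)) ≋ geom α ⊛ invPoch (α + 2) 2 (suc n)
invPoch-uncons α n = ≋-trans (prodTo-uncons (suc n) (λ j → geom (α + j * 2)))
  (⊛-cong (≋-reflexive (cong geom (ℕ.+-identityʳ α)))
          (prodTo-cong (suc n) λ j → ≋-reflexive (cong geom (sym (ℕ.+-assoc α 2 (j * 2))))))

geom²-inverse : ∀ a → 1 ≤ a → (geom a ⊛ geom a) ⊛ (oneMinusQ a ⊛ oneMinusQ a) ≋ one
geom²-inverse a 1≤a = begin
    (geom a ⊛ geom a) ⊛ (oneMinusQ a ⊛ oneMinusQ a)
  ≈⟨ PS-MonoidSolver.solve 2 (λ g u → (g ∙ g) ∙ (u ∙ u) ⊜ (g ∙ u) ∙ (g ∙ u)) ≋-refl (geom a) (oneMinusQ a) ⟩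
    (geom a ⊛ oneMinusQ a) ⊛ (geom a ⊛ oneMinusQ a)
  ≈⟨ ⊛-cong (geom-inverse a 1≤a) (geom-inverse a 1≤a) ⟩
    one ⊛ one
  ≈⟨ ⊛-identityˡ one ⟩
    one
  ∎
  where open ≋-Reasoning

ρ-head : ∀ α → 1 ≤ α → oneMinusQ α ⊛ oneMinusQ α ⊛ ρ α 0 ≋ one
ρ-head α 1≤α = begin
    oneMinusQ α ⊛ oneMinusQ α ⊛ (one ⊛ (one ⊛ geom (α + 0)) ⊛ (one ⊛ geom (α + 0)))
  ≡⟨ cong (λ β → oneMinusQ α ⊛ oneMinusQ α ⊛ (one ⊛ (one ⊛ geom β) ⊛ (one ⊛ geom β))) (ℕ.+-identityʳ α) ⟩
    oneMinusQ α ⊛ oneMinusQ α ⊛ (one ⊛ (one ⊛ geom α) ⊛ (one ⊛ geom α))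
  ≈⟨ PS-Solver.solve 2 (λ u g → u :* u :* (con 1ℤ :* (con 1ℤ :* g) :* (con 1ℤ :* g)) := g :* g :* (u :* u))
       ≋-refl (oneMinusQ α) (geom α) ⟩
    (geom α ⊛ geom α) ⊛ (oneMinusQ α ⊛ oneMinusQ α)
  ≈⟨ geom²-inverse α 1≤α ⟩
    one
  ∎
  where open ≋-Reasoning

ρ-step : ∀ α n → 1 ≤ α → oneMinusQ α ⊛ oneMinusQ α ⊛ ρ α (suc n) ≋ qpow α ⊛ qpow (α + 2) ⊛ ρ (α + 2) n
ρ-step α n 1≤α = begin
    u ⊛ u ⊛ (qpow (2 * suc n * (suc n + α)) ⊛ invPoch α 2 (suc (suc n)) ⊛ invPoch α 2 (suc (suc n)))
  ≈⟨ ⊛-congˡ (u ⊛ u) (⊛-cong (⊛-cong exponent (invPoch-uncons α n)) (invPoch-uncons α n)) ⟩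
    u ⊛ u ⊛ (s ⊛ Q ⊛ (g ⊛ K) ⊛ (g ⊛ K))
  ≈⟨ PS-MonoidSolver.solve 5 (λ u s Q g K → (u ∙ u) ∙ (((s ∙ Q) ∙ (g ∙ K)) ∙ (g ∙ K))
                                          ⊜ (s ∙ ((Q ∙ K) ∙ K)) ∙ ((g ∙ g) ∙ (u ∙ u))) ≋-refl u s Q g K ⟩
    s ⊛ ρ (α + 2) n ⊛ ((g ⊛ g) ⊛ (u ⊛ u))
  ≈⟨ ⊛-congˡ (s ⊛ ρ (α + 2) n) (geom²-inverse α 1≤α) ⟩
    s ⊛ ρ (α + 2) n ⊛ one
  ≈⟨ ⊛-identityʳ (s ⊛ ρ (α + 2) n) ⟩
    s ⊛ ρ (α + 2) n
  ∎
  where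
  open ≋-Reasoning
  u = oneMinusQ α
  g = geom α
  s = qpow α ⊛ qpow (α + 2)
  Q = qpow (2 * n * (n + (α + 2)))
  K = invPoch (α + 2) 2 (suc n)
  exponent-split : ∀ n α → 2 * suc n * (suc n + α) ≡ α + (α + 2) + 2 * n * (n + (α + 2))
  exponent-split = solve-∀
  exponent : qpow (2 * suc n * (suc n + α)) ≋ s ⊛ Q
  exponent = begin
    qpow (2 * suc n * (suc n + α))                 ≡⟨ cong qpow (exponent-split n α) ⟩
    qpow (α + (α + 2) + 2 * n * (n + (α + 2)))     ≈⟨ ≋-sym (qpow-+ (α + (α + 2)) _) ⟩
    qpow (α + (α + 2)) ⊛ Q                         ≈⟨ ⊛-congʳ Q (≋-sym (qpow-+ α (α + 2))) ⟩
    s ⊛ Q                                          ∎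

R-recurrence : ∀ α → 1 ≤ α →
  oneMinusQ α ⊛ oneMinusQ α ⊛ R α ≋ one ⊕ qpow α ⊛ qpow (α + 2) ⊛ R (α + 2)
R-recurrence α 1≤α = begin
    u² ⊛ R α
  ≈⟨ ⊛-sumInf u² (ρ α) (ρ-summable α 1≤α) ⟩
    sumInf (λ n → u² ⊛ ρ α n)
  ≈⟨ sumInf-uncons (λ n → u² ⊛ ρ α n) (λ n → order-⊛ʳ u² n (ρ-summable α 1≤α n)) ⟩
    u² ⊛ ρ α 0 ⊕ sumInf (λ n → u² ⊛ ρ α (suc n))
  ≈⟨ ⊕-cong (ρ-head α 1≤α) (sumInf-cong λ n → ρ-step α n 1≤α) ⟩
    one ⊕ sumInf (λ n → s ⊛ ρ (α + 2) n)
  ≈⟨ ⊕-cong (≋-refl {one}) (≋-sym (⊛-sumInf s (ρ (α + 2)) (ρ-summable (α + 2) 1≤α+2))) ⟩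
    one ⊕ s ⊛ R (α + 2)
  ∎
  where
  open ≋-Reasoning
  u² = oneMinusQ α ⊛ oneMinusQ α
  s = qpow α ⊛ qpow (α + 2)
  1≤α+2 = ℕ.≤-trans 1≤α (ℕ.m≤m+n α 2)

vanishes-by-descent : ∀ {A : Set} (next : A → A) (D g : A → PS) →
  (∀ a → g a ≡ 0ₚ mod-q^ 1) → (∀ a → D a ≋ g a ⊛ D (next a)) → ∀ a → D a ≋ 0ₚ
vanishes-by-descent next D g g≡0 D≋gD a = ≡-mod-all⇒≋ (λ N → vanishes-below N a)
  where
  vanishes-below : ∀ N a → D a ≡ 0ₚ mod-q^ N
  vanishes-below zero    a = agree-below λ ()
  vanishes-below (suc N) a = ≡-mod-trans (≋⇒≡-mod (suc N) (D≋gD a))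
    (order-⊛ {g a} {D (next a)} 1 N (g≡0 a) (vanishes-below N (next a)))

Φ-diagonal≋R : ∀ α → Φ (suc α) (suc α) ≋ R (suc α)
Φ-diagonal≋R α = coeffwise λ m → ℤ.i-j≡0⇒i≡j _ _ (coeff (vanishes-by-descent (_+ 2) D g g≡0 D≋gD α) m)
  where
  D : ℕ → PS
  D α = Φ (suc α) (suc α) ⊖ R (suc α)
  g : ℕ → PS
  g α = (geom (suc α) ⊛ geom (suc α)) ⊛ (qpow (suc α) ⊛ qpow (suc α + 2))
  g≡0 : ∀ α → g α ≡ 0ₚ mod-q^ 1
  g≡0 α = order-⊛ʳ (geom (suc α) ⊛ geom (suc α)) 1
    (order-⊛ˡ (qpow (suc α + 2)) 1 (≡-mod-weaken (s≤s z≤n) (qpow-order (suc α))))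
  D≋gD : ∀ α → D α ≋ g α ⊛ D (α + 2)
  D≋gD α = begin
      Φ a a ⊖ R a
    ≈⟨ ≋-sym (≋-trans (⊛-congʳ (Φ a a ⊖ R a) (geom²-inverse a (s≤s z≤n))) (⊛-identityˡ (Φ a a ⊖ R a))) ⟩
      ((geom a ⊛ geom a) ⊛ (oneMinusQ a ⊛ oneMinusQ a)) ⊛ (Φ a a ⊖ R a)
    ≈⟨ PS-Solver.solve 4 (λ g² u² x r → g² :* u² :* (x :- r) := g² :* (u² :* x :- u² :* r)) ≋-refl
         (geom a ⊛ geom a) (oneMinusQ a ⊛ oneMinusQ a) (Φ a a) (R a) ⟩
      (geom a ⊛ geom a) ⊛ (oneMinusQ a ⊛ oneMinusQ a ⊛ Φ a a ⊖ oneMinusQ a ⊛ oneMinusQ a ⊛ R a)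
    ≈⟨ ⊛-congˡ (geom a ⊛ geom a) (⊖-cong (Φ-diagonal-recurrence a (s≤s z≤n)) (R-recurrence a (s≤s z≤n))) ⟩
      (geom a ⊛ geom a) ⊛ ((one ⊕ s ⊛ Φ (a + 2) (a + 2)) ⊖ (one ⊕ s ⊛ R (a + 2)))
    ≈⟨ PS-Solver.solve 4 (λ g² s x r → g² :* ((con 1ℤ :+ s :* x) :- (con 1ℤ :+ s :* r))
                                    := g² :* s :* (x :- r))
         ≋-refl (geom a ⊛ geom a) s (Φ (a + 2) (a + 2)) (R (a + 2)) ⟩
      g α ⊛ D (α + 2)
    ∎
    where
    open ≋-Reasoning
    a = suc α
    s = qpow a ⊛ qpow (a + 2)

Φ₁₁≋ω : Φ 1 1 ≋ ω
Φ₁₁≋ω = Φ-diagonal≋R 0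

-- The leading term of q ω - F_{k,1}

one⊖P-order : ∀ b → one ⊖ P b ≡ 0ₚ mod-q^ b
one⊖P-order b = agree-below λ {m} m<b →
  trans (cong (one m -ℤ_) (coeff< (P-≡-one b) m<b)) (ℤ.+-inverseʳ (one m))

one⊖P≡qpow : ∀ b → one ⊖ P b ≡ qpow b mod-q^ (b + 2)
one⊖P≡qpow b = begin
  one ⊖ P b                        ≈⟨ ≋⇒≡-mod N (⊖-congˡ one (P-uncons b)) ⟩
  one ⊖ oneMinusQ b ⊛ P (b + 2)    ≈⟨ ⊖-congˡ-mod one (⊛-cong-mod (≋⇒≡-mod N (≋-refl {oneMinusQ b})) (P-≡-one N)) ⟩
  one ⊖ oneMinusQ b ⊛ one          ≈⟨ ≋⇒≡-mod N (PS-Solver.solve 1 (λ x → con 1ℤ :- (con 1ℤ :- x) :* con 1ℤ := x)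
                                                                  ≋-refl (qpow b)) ⟩
  qpow b                           ∎
  where
  N = b + 2
  open ≡-mod-Reasoning N
  ⊖-congˡ-mod : ∀ f {g g′} → g ≡ g′ mod-q^ N → f ⊖ g ≡ f ⊖ g′ mod-q^ N
  ⊖-congˡ-mod f g≡g′ = agree-below λ {m} m<N → cong (f m -ℤ_) (coeff< g≡g′ m<N)

W : ℕ → PS
W n = P (2 * n + 2) ⊛ P⁻¹ (2 * n + 1) ⊛ P⁻¹ (2 * n + 1) ⊛ qpow (2 * n + 1)

qω≋ΣW : qpow 1 ⊛ ω ≋ sumInf W
qω≋ΣW = begin
  qpow 1 ⊛ ω                          ≈⟨ ⊛-congˡ (qpow 1) (≋-sym Φ₁₁≋ω) ⟩
  qpow 1 ⊛ Φ 1 1                      ≈⟨ ⊛-sumInf (qpow 1) (φ 1 1) (φ-summable 1 1) ⟩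
  sumInf (λ n → qpow 1 ⊛ φ 1 1 n)     ≈⟨ sumInf-cong q⊛φ≋W ⟩
  sumInf W                            ∎
  where
  open ≋-Reasoning
  q⊛φ≋W : ∀ n → qpow 1 ⊛ φ 1 1 n ≋ W n
  q⊛φ≋W n = begin
      qpow 1 ⊛ (qpow (2 * n) ⊛ p ⊛ x ⊛ x)
    ≈⟨ PS-MonoidSolver.solve 4 (λ q Q p x → q ∙ (((Q ∙ p) ∙ x) ∙ x) ⊜ ((p ∙ x) ∙ x) ∙ (q ∙ Q)) ≋-refl
         (qpow 1) (qpow (2 * n)) p x ⟩
      p ⊛ x ⊛ x ⊛ (qpow 1 ⊛ qpow (2 * n))
    ≈⟨ ⊛-congˡ (p ⊛ x ⊛ x) (≋-trans (qpow-+ 1 (2 * n)) (≋-reflexive (cong qpow (ℕ.+-comm 1 (2 * n))))) ⟩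
      W n
    ∎
    where
    p = P (2 * n + 2)
    x = P⁻¹ (2 * n + 1)

qω⊖F≋ΣW⊛[1⊖P] : ∀ k → qpow 1 ⊛ ω ⊖ F k ≋ sumInf (λ n → W n ⊛ (one ⊖ P (2 * n + 2 * k)))
qω⊖F≋ΣW⊛[1⊖P] k = begin
    qpow 1 ⊛ ω ⊖ F k
  ≈⟨ ⊖-congʳ (F k) qω≋ΣW ⟩
    sumInf W ⊖ F k
  ≈⟨ ≋-sym (sumInf-⊖ W F-term) ⟩
    sumInf (λ n → W n ⊖ F-term n)
  ≈⟨ sumInf-cong (λ n → PS-Solver.solve 4 (λ p r x Q → p :* x :* x :* Q :- p :* r :* x :* x :* Q
                                                   := p :* x :* x :* Q :* (con 1ℤ :- r)) ≋-refl
                           (P (2 * n + 2)) (P (2 * n + 2 * k)) (P⁻¹ (2 * n + 1)) (qpow (2 * n + 1))) ⟩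
    sumInf (λ n → W n ⊛ (one ⊖ P (2 * n + 2 * k)))
  ∎
  where
  open ≋-Reasoning
  F-term : ℕ → PS
  F-term n = P (2 * n + 2) ⊛ P (2 * n + 2 * k) ⊛ P⁻¹ (2 * n + 1) ⊛ P⁻¹ (2 * n + 1) ⊛ qpow (2 * n + 1)

G : PS
G = P 2 ⊛ P⁻¹ 1 ⊛ P⁻¹ 1

G-constant : G 0 ≡ 1ℤ
G-constant = refl

leading-term : ∀ k → qpow 1 ⊛ ω ⊖ F k ≡ qpow (2 * k + 1) ⊛ G mod-q^ suc (2 * k + 1)
leading-term k = ≡-mod-weaken (ℕ.≤-reflexive (sym (ℕ.+-suc (2 * k) 1))) (begin
  qpow 1 ⊛ ω ⊖ F k                 ≈⟨ ≋⇒≡-mod N (qω⊖F≋ΣW⊛[1⊖P] k) ⟩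
  sumInf T                         ≈⟨ sumInf-≡-head N T tail≡0 ⟩
  W 0 ⊛ (one ⊖ P (2 * k))          ≈⟨ ⊛-cong-mod (≋⇒≡-mod N (≋-refl {W 0})) (one⊖P≡qpow (2 * k)) ⟩
  W 0 ⊛ qpow (2 * k)               ≈⟨ ≋⇒≡-mod N W₀⊛q^2k≋q^[2k+1]G ⟩
  qpow (2 * k + 1) ⊛ G             ∎)
  where
  open ≡-mod-Reasoning (2 * k + 2)
  N = 2 * k + 2
  T : ℕ → PS
  T n = W n ⊛ (one ⊖ P (2 * n + 2 * k))
  tail≡0 : ∀ n → T (suc n) ≡ 0ₚ mod-q^ N
  tail≡0 n = order-⊛ʳ (W (suc n)) N (≡-mod-weaken N≤ (one⊖P-order (2 * suc n + 2 * k)))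
    where
    N≤ : N ≤ 2 * suc n + 2 * k
    N≤ = ℕ.≤-trans (ℕ.≤-reflexive (ℕ.+-comm (2 * k) 2)) (ℕ.+-monoˡ-≤ (2 * k) (ℕ.m≤m*n 2 (suc n)))
  W₀⊛q^2k≋q^[2k+1]G : W 0 ⊛ qpow (2 * k) ≋ qpow (2 * k + 1) ⊛ G
  W₀⊛q^2k≋q^[2k+1]G = ≋-trans
    (PS-MonoidSolver.solve 5 (λ p x y q Q → (((p ∙ x) ∙ y) ∙ q) ∙ Q ⊜ (q ∙ Q) ∙ ((p ∙ x) ∙ y)) ≋-refl
       (P 2) (P⁻¹ 1) (P⁻¹ 1) (qpow 1) (qpow (2 * k)))
    (⊛-congʳ G (≋-trans (qpow-+ 1 (2 * k)) (≋-reflexive (cong qpow (ℕ.+-comm 1 (2 * k))))))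

theorem1p5 : (k : ℕ) → 1 ≤ k →
    Σ PS (λ E → (E 0 ≡ 1ℤ) ×
      ((m : ℕ) → (qpow 1 ⊛ ω ⊖ F k) m ≡ (qpow (2 * k + 1) ⊛ E) m))
theorem1p5 k _ =
  let E , E₀≡G₀ , D≋q^[2k+1]E = qpow-quotient (2 * k + 1) G (leading-term k)
  in  E , trans E₀≡G₀ G-constant , coeff D≋q^[2k+1]E
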